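{- Let $\mathcal{P}$ be a profile of unrooted phylogenetic trees whose display graph $G(\mathcal{P})$ is connected, and let $F\subseteq E(G(\mathcal{P}))$. Then $F$ is a legal minimal separator of $LG(\mathcal{P})$ if and only if $F$ is a nice minimal cut of $G(\mathcal{P})$.
   Context: A phylogenetic tree $T$ is an unrooted tree whose leaves are bijectively labelled by a finite set $\mathcal{L}(T)$; leaves are identified with labels. A profile is a finite collection $\mathcal{P}=\{T_1,\dots,T_k\}$ of phylogenetic trees with pairwise disjoint sets of internal vertices. The display graph $G(\mathcal{P})$ has vertex set $\bigcup_iV(T_i)$ and edge set $\bigcup_iE(T_i)$. $LG(\mathcal{P})$ is the line graph of $G(\mathcal{P})$: vertex set $E(G(\mathcal{P}))$, two vertices adjacent iff the edges share an endpoint; $LG(T)$ is the line graph of $T\in\mathcal{P}$ on vertex set $E(T)$. In a graph $G$, for nonadjacent vertices $a,b$, an $a$-$b$ separator is $U\subset V(G)$ with $a,b$ in different components of $G-U$; minimal if no proper subset is an $a$-$b$ separator; $U$ is a minimal separator if it is a minimal $a$-$b$ separator for some nonadjacent $a,b$. A minimal separator $F$ of $LG(\mathcal{P})$ is legal if for every $T\in\mathcal{P}$ all edges of $T$ in $F$ share a common endpoint (i.e., $F\cap E(T)$ is a clique in $LG(T)$). A cut of a connected graph $G$ is $F\subseteq E(G)$ with $G-F$ (vertex set $V(G)$, edges $E(G)\setminus F$) disconnected; minimal if no proper subset is a cut. $\mathrm{Inc}(u)$ is the set of edges of $G(\mathcal{P})$ incident to $u$. A cut $F$ of $G(\mathcal{P})$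 is legal if for each $T\in\mathcal{P}$ there is $u\in V(T)$ with $F\cap E(T)\subseteq\mathrm{Inc}(u)$, and nice if it is legal and every connected component of $G(\mathcal{P})-F$ has at least one edge. -}

module Defs where

open import Data.Nat using (ℕ; _<_; _≤_)
open import Data.Fin using (Fin)
open import Data.Product using (Σ; ∃; ∃-syntax; _×_; _,_; proj₁; proj₂)
open import Data.Sum using (_⊎_)
open import Data.List using (List; []; _∷_; length; _∷ʳ_)
open import Data.List.Membership.Propositional using (_∈_; _∉_)
open import Data.List.Relation.Unary.Unique.Propositional using (Unique)
open import Relation.Nullary using (¬_)
open import Relation.Binary.PropositionalEquality using (_≡_; _≢_)

-- Leaves are identified with their
--    labels, so the label set L(T) is the set of leaves of T.
--  * An (undirected) edge {u,v} is stored as the ordered pair (u , v)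
--    with u < v, so equal edges are equal pairs.
--  * Finite sets are lists, read up to membership.

Edge : Set
Edge = ℕ × ℕ

Incident : ℕ → Edge → Set
Incident u e = (u ≡ proj₁ e) ⊎ (u ≡ proj₂ e)

ShareEnd : Edge → Edge → Set
ShareEnd e e' = ∃[ u ] (Incident u e × Incident u e')

AdjBy : (Edge → Set) → ℕ → ℕ → Set
AdjBy E u v = E (u , v) ⊎ E (v , u)

data Walk {A : Set} (R : A → A → Set) (Ok : A → Set) : A → A → Set where
  here : ∀ {x} → Ok x → Walk R Ok x x
  step : ∀ {x y z} → Ok x → R x y → Walk R Ok y z → Walk R Ok x z

data Chain {A : Set} (R : A → A → Set) : List A → Set where
  []  : Chain R []
  [-] : ∀ {x} → Chain R (x ∷ [])
  _∷_ : ∀ {x y xs} → R x y → Chain R (y ∷ xs) → Chain R (x ∷ y ∷ xs)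

HasCycle : (ℕ → ℕ → Set) → Set
HasCycle R = ∃[ x ] ∃[ ys ] (2 ≤ length ys × Unique (x ∷ ys) × Chain R ((x ∷ ys) ∷ʳ x))

record PhyloTree : Set where
  field
    V : List ℕ
    E : List Edge
    nonempty  : ∃[ v ] (v ∈ V)
    E-ordered : ∀ {e} → e ∈ E → proj₁ e < proj₂ e
    E-in-V    : ∀ {e} → e ∈ E → (proj₁ e ∈ V) × (proj₂ e ∈ V)
    connected : ∀ {u v} → u ∈ V → v ∈ V → Walk (AdjBy (_∈ E)) (_∈ V) u v
    acyclic   : ¬ HasCycle (AdjBy (_∈ E))

open PhyloTree public

Leaf : PhyloTree → ℕ → Set
Leaf T v = v ∈ V T × (∀ {e e'} → e ∈ E T → e' ∈ E T → Incident v e → Incident v e' → e ≡ e')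

Internal : PhyloTree → ℕ → Set
Internal T v = v ∈ V T × ¬ Leaf T v

-- Profiles: trees with pairwise disjoint sets of internal vertices
-- (and, since leaves are labels, no label is an internal vertex).

record Profile : Set where
  field
    k     : ℕ
    tree  : Fin k → PhyloTree
    internal-disjoint : ∀ {i j v} → i ≢ j → Internal (tree i) v → ¬ Internal (tree j) v
    labels-not-internal : ∀ {i j v} → Leaf (tree i) v → ¬ Internal (tree j) v

open Profile public

module _ (P : Profile) where

  GV : ℕ → Set
  GV v = ∃[ i ] (v ∈ V (tree P i))

  GE : Edge → Set
  GE e = ∃[ i ] (e ∈ E (tree P i))

  Connected : Set
  Connected = ∀ {u v} → GV u → GV v → Walk (AdjBy GE) GV u v

  LGAdj : Edge → Edge → Set
  LGAdj e e' = e ≢ e' × ShareEnd e e'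

  IsSeparator : Edge → Edge → List Edge → Set
  IsSeparator a b U =
    (∀ {e} → e ∈ U → GE e) × GE a × GE b × ¬ LGAdj a b ×
    a ∉ U × b ∉ U × ¬ Walk LGAdj (λ e → GE e × e ∉ U) a b

  IsMinimalSeparatorFor : Edge → Edge → List Edge → Set
  IsMinimalSeparatorFor a b U =
    IsSeparator a b U ×
    (∀ (U' : List Edge) → (∀ {e} → e ∈ U' → e ∈ U) → (∃[ e ] (e ∈ U × e ∉ U')) →
       ¬ IsSeparator a b U')

  IsMinimalSeparator : List Edge → Set
  IsMinimalSeparator U = ∃[ a ] ∃[ b ] IsMinimalSeparatorFor a b U

  IsLegalSeparator : List Edge → Set
  IsLegalSeparator F =
    ∀ (i : Fin (k P)) {e e'} → e ∈ F → e ∈ E (tree P i) → e' ∈ F → e' ∈ E (tree P i) →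
      e ≡ e' ⊎ LGAdj e e'

  AdjMinus : List Edge → ℕ → ℕ → Set
  AdjMinus F = AdjBy (λ e → GE e × e ∉ F)

  IsCut : List Edge → Set
  IsCut F = (∀ {e} → e ∈ F → GE e) ×
            ∃[ u ] ∃[ v ] (GV u × GV v × ¬ Walk (AdjMinus F) GV u v)

  IsMinimalCut : List Edge → Set
  IsMinimalCut F =
    IsCut F ×
    (∀ (F' : List Edge) → (∀ {e} → e ∈ F' → e ∈ F) → (∃[ e ] (e ∈ F × e ∉ F')) → ¬ IsCut F')

  IsLegalCut : List Edge → Set
  IsLegalCut F =
    ∀ (i : Fin (k P)) → ∃[ u ] (u ∈ V (tree P i) ×
      (∀ {e} → e ∈ F → e ∈ E (tree P i) → Incident u e))

  IsNiceCut : List Edge → Set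
  IsNiceCut F =
    IsLegalCut F ×
    (∀ {u} → GV u → ∃[ e ] (GE e × e ∉ F × Walk (AdjMinus F) GV u (proj₁ e)))

-- A walk in LG(P) − F from an edge g to an edge h is the same thing, up to
-- its first and last edges, as a walk in G(P) − F between endpoints of g and
-- h.  Hence F separates two edges of the line graph exactly when it
-- disconnects their endpoints, and minimality transfers in both directions.
-- Legality transfers because edges of a tree that pairwise share an endpoint
-- all share one (a tree has no triangle).  Niceness comes from minimality of
-- the separator: every edge of F is adjacent both to the component of a and
-- to that of b in LG(P) − F, so, G(P) being connected, every vertex lies on
-- an edge outside F.
module Submission where

open import Defs
open import Data.List using (List)
open import Data.List.Membership.Propositional using (_∈_)
open import Data.Product using (_×_)
open import Function.Bundles using (_⇔_)

open import Data.Empty using (⊥; ⊥-elim)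
import Data.Fin.Properties as Fin
open import Data.List using ([]; _∷_; filter)
open import Data.List.Membership.Propositional using (_∉_; find; lose)
open import Data.List.Membership.Propositional.Properties using (∈-filter⁺; ∈-filter⁻)
open import Data.List.Relation.Unary.All using (All; []; _∷_; all?)
import Data.List.Relation.Unary.All as All
open import Data.List.Relation.Unary.All.Properties.Core using (¬All⇒Any¬)
open import Data.List.Relation.Unary.AllPairs.Core using ([]; _∷_)
open import Data.List.Relation.Unary.Any using (Any; here; any?)
open import Data.Nat using (ℕ; s≤s; z≤n) renaming (_≟_ to _≟ℕ_)
open import Data.Nat.Properties using (<⇒≢)
open import Data.Product using (∃-syntax; _,_; proj₁; proj₂)
import Data.Product.Properties as Product
open import Data.Sum using (_⊎_; inj₁; inj₂; [_,_]′; map₁)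
open import Function using (id)
open import Function.Bundles using (mk⇔)
open import Relation.Binary.Definitions using (Symmetric; DecidableEquality)
open import Relation.Binary.PropositionalEquality using (_≡_; _≢_; refl; sym)
open import Relation.Nullary using (¬_; Dec; yes; no)
open import Relation.Nullary.Decidable using (_⊎-dec_; _×-dec_; ¬?; decidable-stable)

module WalkProperties {A : Set} {R : A → A → Set} {Ok : A → Set} where

  start : ∀ {x y} → Walk R Ok x y → Ok x
  start (here x-ok)     = x-ok
  start (step x-ok _ _) = x-ok

  infixr 5 _++ʷ_

  _++ʷ_ : ∀ {x y z} → Walk R Ok x y → Walk R Ok y z → Walk R Ok x z
  here _          ++ʷ W' = W'
  step x-ok r W   ++ʷ W' = step x-ok r (W ++ʷ W')

  snoc : ∀ {x y z} → Walk R Ok x y → R y z → Ok z → Walk R Ok x z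
  snoc (here x-ok)        r z-ok = step x-ok r (here z-ok)
  snoc (step x-ok r' W)   r z-ok = step x-ok r' (snoc W r z-ok)

  reverse : Symmetric R → ∀ {x y} → Walk R Ok x y → Walk R Ok y x
  reverse sym-R (here x-ok)     = here x-ok
  reverse sym-R (step x-ok r W) = snoc (reverse sym-R W) (sym-R r) x-ok

  map : ∀ {R' : A → A → Set} {Ok' : A → Set} → (∀ {x} → Ok x → Ok' x) →
        (∀ {x y} → R x y → R' x y) → ∀ {x y} → Walk R Ok x y → Walk R' Ok' x y
  map f g (here x-ok)     = here (f x-ok)
  map f g (step x-ok r W) = step (f x-ok) (g r) (map f g W)

open WalkProperties

_≟ᴱ_ : DecidableEquality Edge
_≟ᴱ_ = Product.≡-dec _≟ℕ_ _≟ℕ_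

incident? : (u : ℕ) (e : Edge) → Dec (Incident u e)
incident? u e = (u ≟ℕ proj₁ e) ⊎-dec (u ≟ℕ proj₂ e)

AdjBy-sym : ∀ {E : Edge → Set} → Symmetric (AdjBy E)
AdjBy-sym (inj₁ uv) = inj₂ uv
AdjBy-sym (inj₂ vu) = inj₁ vu

AdjBy⇒edge : ∀ {E : Edge → Set} {u v} → AdjBy E u v → ∃[ e ] (E e × Incident u e × Incident v e)
AdjBy⇒edge {u = u} {v} (inj₁ uv) = (u , v) , uv , inj₁ refl , inj₂ refl
AdjBy⇒edge {u = u} {v} (inj₂ vu) = (v , u) , vu , inj₂ refl , inj₁ refl

edge⇒AdjBy : ∀ {E : Edge → Set} {e u v} → E e → Incident u e → Incident v e → u ≢ v → AdjBy E u v
edge⇒AdjBy e∈E (inj₁ refl) (inj₁ refl) u≢v = ⊥-elim (u≢v refl)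
edge⇒AdjBy e∈E (inj₁ refl) (inj₂ refl) u≢v = inj₁ e∈E
edge⇒AdjBy e∈E (inj₂ refl) (inj₁ refl) u≢v = inj₂ e∈E
edge⇒AdjBy e∈E (inj₂ refl) (inj₂ refl) u≢v = ⊥-elim (u≢v refl)

incident-one-of-two : ∀ {c d d' e} → Incident c e → Incident d e → Incident d' e → d ≢ d' →
                      c ≡ d ⊎ c ≡ d'
incident-one-of-two (inj₁ refl) (inj₁ refl) _           _     = inj₁ refl
incident-one-of-two (inj₁ refl) (inj₂ _)    (inj₁ refl) _     = inj₂ refl
incident-one-of-two (inj₁ refl) (inj₂ refl) (inj₂ refl) d≢d' = ⊥-elim (d≢d' refl)
incident-one-of-two (inj₂ refl) (inj₂ refl) _           _     = inj₁ refl
incident-one-of-two (inj₂ refl) (inj₁ _)    (inj₂ refl) _     = inj₂ refl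
incident-one-of-two (inj₂ refl) (inj₁ refl) (inj₁ refl) d≢d' = ⊥-elim (d≢d' refl)

ShareEnd⇒incident₂ : ∀ {e g} → ShareEnd e g → ¬ Incident (proj₁ e) g → Incident (proj₂ e) g
ShareEnd⇒incident₂ (_ , inj₁ refl , c∣g) ¬₁∣g = ⊥-elim (¬₁∣g c∣g)
ShareEnd⇒incident₂ (_ , inj₂ refl , c∣g) ¬₁∣g = c∣g

ShareEnd⇒incident₁ : ∀ {e g} → ShareEnd e g → ¬ Incident (proj₂ e) g → Incident (proj₁ e) g
ShareEnd⇒incident₁ (_ , inj₁ refl , c∣g) ¬₂∣g = c∣g
ShareEnd⇒incident₁ (_ , inj₂ refl , c∣g) ¬₂∣g = ⊥-elim (¬₂∣g c∣g)

module _ (T : PhyloTree) where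

  private
    Adj : ℕ → ℕ → Set
    Adj = AdjBy (_∈ E T)

  triangle-free : ∀ {x y z} → Adj x y → Adj y z → Adj z x → x ≢ y → y ≢ z → z ≢ x → ⊥
  triangle-free {x} {y} {z} xy yz zx x≢y y≢z z≢x =
    acyclic T (x , y ∷ z ∷ [] , s≤s (s≤s z≤n) ,
               ((x≢y ∷ (λ x≡z → z≢x (sym x≡z)) ∷ []) ∷ (y≢z ∷ []) ∷ [] ∷ []) ,
               xy ∷ yz ∷ zx ∷ [-])

  ¬edge-triangle : ∀ {x y g h} → (x , y) ∈ E T → g ∈ E T → h ∈ E T →
                   ShareEnd (x , y) g → ShareEnd (x , y) h → ShareEnd g h →
                   ¬ Incident x g → ¬ Incident y h → ⊥
  ¬edge-triangle {x} {y} {g} {h} e∈T g∈T h∈T e~g e~h (d , d∣g , d∣h) x∤g y∤h =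
    triangle-free (inj₁ e∈T) (edge⇒AdjBy g∈T y∣g d∣g y≢d) (edge⇒AdjBy h∈T d∣h x∣h d≢x)
                  (<⇒≢ (E-ordered T e∈T)) y≢d d≢x
    where
    y∣g : Incident y g
    y∣g = ShareEnd⇒incident₂ e~g x∤g
    x∣h : Incident x h
    x∣h = ShareEnd⇒incident₁ e~h y∤h
    y≢d : y ≢ d
    y≢d refl = y∤h d∣h
    d≢x : d ≢ x
    d≢x refl = x∤g d∣g

  pairwise-ShareEnd⇒star : (Es : List Edge) → (∀ {e} → e ∈ Es → e ∈ E T) →
                           (∀ {e e'} → e ∈ Es → e' ∈ Es → ShareEnd e e') →
                           ∃[ u ] (u ∈ V T × All (Incident u) Es)
  pairwise-ShareEnd⇒star [] _ _ = proj₁ (nonempty T) , proj₂ (nonempty T) , []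
  pairwise-ShareEnd⇒star Es@((x , y) ∷ _) Es⊆T share
    with all? (incident? x) Es | all? (incident? y) Es
  ... | yes all-x | _        = x , proj₁ (E-in-V T (Es⊆T (here refl))) , all-x
  ... | no _      | yes all-y = y , proj₂ (E-in-V T (Es⊆T (here refl))) , all-y
  ... | no ¬all-x | no ¬all-y
    with find (¬All⇒Any¬ (incident? x) Es ¬all-x) | find (¬All⇒Any¬ (incident? y) Es ¬all-y)
  ... | g , g∈Es , x∤g | h , h∈Es , y∤h =
    ⊥-elim (¬edge-triangle (Es⊆T (here refl)) (Es⊆T g∈Es) (Es⊆T h∈Es)
                           (share (here refl) g∈Es) (share (here refl) h∈Es) (share g∈Es h∈Es)
                           x∤g y∤h)

open import Data.List.Membership.DecPropositional _≟ᴱ_ using (_∈?_)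

_without_ : List Edge → Edge → List Edge
F without f = filter (λ e → ¬? (e ≟ᴱ f)) F

∈-without⁺ : ∀ {F f e} → e ∈ F → e ≢ f → e ∈ F without f
∈-without⁺ {f = f} = ∈-filter⁺ (λ e → ¬? (e ≟ᴱ f))

∈-without⁻ : ∀ {F f e} → e ∈ F without f → e ∈ F × e ≢ f
∈-without⁻ {F} {f} = ∈-filter⁻ (λ e → ¬? (e ≟ᴱ f)) {xs = F}

module _ (P : Profile) where

  Avoids : List Edge → Edge → Set
  Avoids F e = GE P e × e ∉ F

  LGWalk : List Edge → Edge → Edge → Set
  LGWalk F = Walk (LGAdj P) (Avoids F)

  GWalk : List Edge → ℕ → ℕ → Set
  GWalk F = Walk (AdjMinus P F) (GV P)

  LGAdj-sym : Symmetric (LGAdj P)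
  LGAdj-sym (e≢e' , c , c∣e , c∣e') = (λ e'≡e → e≢e' (sym e'≡e)) , c , c∣e' , c∣e

  incident⇒GV : ∀ {g u} → GE P g → Incident u g → GV P u
  incident⇒GV (i , g∈T) (inj₁ refl) = i , proj₁ (E-in-V (tree P i) g∈T)
  incident⇒GV (i , g∈T) (inj₂ refl) = i , proj₂ (E-in-V (tree P i) g∈T)

  ShareEnd⇒LGWalk : ∀ {F g h} → Avoids F g → Avoids F h → ShareEnd g h → LGWalk F g h
  ShareEnd⇒LGWalk {g = g} {h} g-ok h-ok g~h with g ≟ᴱ h
  ... | yes refl = here g-ok
  ... | no g≢h   = step g-ok (g≢h , g~h) (here h-ok)

  LGWalk-antimono : ∀ {F F'} → (∀ {e} → e ∈ F' → e ∈ F) → ∀ {g h} → LGWalk F g h → LGWalk F' g h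
  LGWalk-antimono F'⊆F = map (λ (e∈G , e∉F) → e∈G , λ e∈F' → e∉F (F'⊆F e∈F')) id

  GWalk-along-edge : ∀ {F g x z} → Avoids F g → Incident x g → Incident z g → GWalk F x z
  GWalk-along-edge {x = x} {z} g-ok@(g∈G , _) x∣g z∣g with x ≟ℕ z
  ... | yes refl = here (incident⇒GV g∈G x∣g)
  ... | no x≢z   = step (incident⇒GV g∈G x∣g) (edge⇒AdjBy g-ok x∣g z∣g x≢z)
                        (here (incident⇒GV g∈G z∣g))

  LGWalk⇒GWalk : ∀ {F g h x z} → LGWalk F g h → Incident x g → Incident z h → GWalk F x z
  LGWalk⇒GWalk (here g-ok) x∣g z∣g = GWalk-along-edge g-ok x∣g z∣g
  LGWalk⇒GWalk (step g-ok (_ , c , c∣g , c∣g') W) x∣g z∣h =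
    GWalk-along-edge g-ok x∣g c∣g ++ʷ LGWalk⇒GWalk W c∣g' z∣h

  GWalk⇒LGWalk : ∀ {F g h x z} → GWalk F x z → Avoids F g → Incident x g →
                 Avoids F h → Incident z h → LGWalk F g h
  GWalk⇒LGWalk {x = x} (here _) g-ok x∣g h-ok x∣h = ShareEnd⇒LGWalk g-ok h-ok (x , x∣g , x∣h)
  GWalk⇒LGWalk {x = x} (step _ x~y W) g-ok x∣g h-ok z∣h with AdjBy⇒edge x~y
  ... | e , e-ok , x∣e , y∣e =
    ShareEnd⇒LGWalk g-ok e-ok (x , x∣g , x∣e) ++ʷ GWalk⇒LGWalk W e-ok y∣e h-ok z∣h

  avoids-without : ∀ {F f x} → Avoids (F without f) x → x ≢ f → Avoids F x
  avoids-without (x∈G , x∉F∖f) x≢f = x∈G , λ x∈F → x∉F∖f (∈-without⁺ x∈F x≢f)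

  walk-or-last-exit : ∀ F {f x t} → LGWalk (F without f) x t → x ≢ f → t ≢ f →
                      LGWalk F x t ⊎ ∃[ h ] (LGAdj P f h × LGWalk F h t)
  walk-or-last-exit F (here x-ok) x≢f t≢f = inj₁ (here (avoids-without x-ok x≢f))
  walk-or-last-exit F {f} (step {y = y} x-ok x~y W) x≢f t≢f with y ≟ᴱ f
  ... | no y≢f = map₁ (step (avoids-without x-ok x≢f) x~y) (walk-or-last-exit F W y≢f t≢f)
  walk-or-last-exit F (step _ _ (here _))         x≢f t≢f | yes refl = ⊥-elim (t≢f refl)
  walk-or-last-exit F (step _ _ (step _ f~z W)) x≢f t≢f | yes refl =
    inj₂ ([ (λ W' → _ , f~z , W') , id ]′
            (walk-or-last-exit F W (λ z≡f → proj₁ f~z (sym z≡f)) t≢f))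

  legal-separator⇒legal-cut : ∀ {F} → IsLegalSeparator P F → IsLegalCut P F
  legal-separator⇒legal-cut {F} legal i =
    let u , u∈T , star = pairwise-ShareEnd⇒star T Es Es⊆T share
    in  u , u∈T , λ e∈F e∈T → All.lookup star (∈-filter⁺ (_∈? E T) e∈F e∈T)
    where
    T : PhyloTree
    T = tree P i
    Es : List Edge
    Es = filter (_∈? E T) F
    Es⊆T : ∀ {e} → e ∈ Es → e ∈ E T
    Es⊆T e∈Es = proj₂ (∈-filter⁻ (_∈? E T) {xs = F} e∈Es)
    share : ∀ {e e'} → e ∈ Es → e' ∈ Es → ShareEnd e e'
    share e∈Es e'∈Es with ∈-filter⁻ (_∈? E T) {xs = F} e∈Es | ∈-filter⁻ (_∈? E T) {xs = F} e'∈Es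
    ... | e∈F , e∈T | e'∈F , e'∈T with legal i e∈F e∈T e'∈F e'∈T
    ... | inj₁ refl       = _ , inj₁ refl , inj₁ refl
    ... | inj₂ (_ , e~e') = e~e'

  module Forward (connected : Connected P) {F : List Edge} (F⊆G : ∀ {e} → e ∈ F → GE P e)
                 {a b : Edge} (a∈G : GE P a) (b∈G : GE P b) (a≁b : ¬ LGAdj P a b)
                 (a∉F : a ∉ F) (b∉F : b ∉ F) (no-walk : ¬ LGWalk F a b)
                 (minimal : ∀ U → (∀ {e} → e ∈ U → e ∈ F) → ∃[ e ] (e ∈ F × e ∉ U) →
                            ¬ IsSeparator P a b U)
                 where

    proper-sublist-leaks : ∀ U → (∀ {e} → e ∈ U → e ∈ F) → ∃[ e ] (e ∈ F × e ∉ U) →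
                           ¬ ¬ LGWalk U a b
    proper-sublist-leaks U U⊆F strict no-walk-U =
      minimal U U⊆F strict ((λ e∈U → F⊆G (U⊆F e∈U)) , a∈G , b∈G , a≁b ,
                            (λ a∈U → a∉F (U⊆F a∈U)) , (λ b∈U → b∉F (U⊆F b∈U)) , no-walk-U)

    ReachesAB : Edge → Set
    ReachesAB g = LGWalk F g a ⊎ LGWalk F g b

    Touches : ℕ → Set
    Touches x = ∃[ g ] (Incident x g × ReachesAB g)

    ReachesAB⇒Avoids : ∀ {g} → ReachesAB g → Avoids F g
    ReachesAB⇒Avoids (inj₁ W) = start W
    ReachesAB⇒Avoids (inj₂ W) = start W

    ReachesAB-extend : ∀ {g h} → Avoids F h → ShareEnd h g → ReachesAB g → ReachesAB h
    ReachesAB-extend h-ok h~g (inj₁ W) = inj₁ (ShareEnd⇒LGWalk h-ok (start W) h~g ++ʷ W)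
    ReachesAB-extend h-ok h~g (inj₂ W) = inj₂ (ShareEnd⇒LGWalk h-ok (start W) h~g ++ʷ W)

    -- F ∖ f no longer separates, so an a–b walk must pass through f; its
    -- neighbours around the first and last visits lead back to a and on to b.
    removed-edge-bridges : ∀ {f} → f ∈ F →
      ¬ ¬ ((∃[ g ] LGAdj P f g × LGWalk F g a) × (∃[ h ] LGAdj P f h × LGWalk F h b))
    removed-edge-bridges {f} f∈F ¬bridge =
      proper-sublist-leaks (F without f) (λ e∈F∖f → proj₁ (∈-without⁻ {F} e∈F∖f))
                           (f , f∈F , λ f∈F∖f → proj₂ (∈-without⁻ {F} f∈F∖f) refl) blocked
      where
      a≢f : a ≢ f
      a≢f refl = a∉F f∈F
      b≢f : b ≢ f
      b≢f refl = b∉F f∈F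
      blocked : ¬ LGWalk (F without f) a b
      blocked W with walk-or-last-exit F W a≢f b≢f
                   | walk-or-last-exit F (reverse LGAdj-sym W) b≢f a≢f
      ... | inj₁ W-F | _         = no-walk W-F
      ... | inj₂ _   | inj₁ W-F  = no-walk (reverse LGAdj-sym W-F)
      ... | inj₂ to-b | inj₂ to-a = ¬bridge (to-a , to-b)

    removed-edge-touches : ∀ {f c} → f ∈ F → Incident c f → ¬ ¬ Touches c
    removed-edge-touches {f} f∈F c∣f ¬touch = removed-edge-bridges f∈F
      λ { ((g , (_ , d , d∣f , d∣g) , g→a) , (h , (_ , d' , d'∣f , d'∣h) , h→b)) →
          compare-shared-ends g→a h→b d∣g d'∣h (d ≟ℕ d') d∣f d'∣f }
      where
      compare-shared-ends : ∀ {g h d d'} → LGWalk F g a → LGWalk F h b → Incident d g → Incident d' h →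
                  Dec (d ≡ d') → Incident d f → Incident d' f → ⊥
      compare-shared-ends g→a h→b d∣g d'∣h (yes refl) _ _ =
        no-walk (reverse LGAdj-sym g→a ++ʷ ShareEnd⇒LGWalk (start g→a) (start h→b) (_ , d∣g , d'∣h)
                 ++ʷ h→b)
      compare-shared-ends g→a h→b d∣g d'∣h (no d≢d') d∣f d'∣f with incident-one-of-two c∣f d∣f d'∣f d≢d'
      ... | inj₁ refl = ¬touch (_ , d∣g , inj₁ g→a)
      ... | inj₂ refl = ¬touch (_ , d'∣h , inj₂ h→b)

    connected-touches : ∀ {x} → Walk (AdjBy (GE P)) (GV P) x (proj₁ a) → ¬ ¬ Touches x
    connected-touches (here _) ¬touch = ¬touch (a , inj₁ refl , inj₁ (here (a∈G , a∉F)))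
    connected-touches (step _ x~y W) ¬touch with AdjBy⇒edge x~y
    ... | h , h∈G , x∣h , y∣h with h ∈? F
    ... | yes h∈F = removed-edge-touches h∈F x∣h ¬touch
    ... | no h∉F  = connected-touches W λ (g , y∣g , g-reaches) →
                      ¬touch (h , x∣h , ReachesAB-extend (h∈G , h∉F) (_ , y∣h , y∣g) g-reaches)

    every-vertex-touches : ∀ {x} → GV P x → ¬ ¬ Touches x
    every-vertex-touches x∈G = connected-touches (connected x∈G (incident⇒GV a∈G (inj₁ refl)))

    -- Touching is only known up to double negation; the conclusion we need
    -- from it is decidable, hence stable.
    avoiding-edge-at : ∀ {u} → GV P u → ∃[ e ] (Avoids F e × Incident u e)
    avoiding-edge-at {u} u∈G =
      let i , any-e = decidable-stable avoiding-edge? λ ¬avoiding →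
                        every-vertex-touches u∈G λ (g , u∣g , g-reaches) →
                          let (i , g∈T) , g∉F = ReachesAB⇒Avoids g-reaches
                          in  ¬avoiding (i , lose g∈T (g∉F , u∣g))
          e , e∈T , e∉F , u∣e = find any-e
      in  e , ((i , e∈T) , e∉F) , u∣e
      where
      avoiding-edge? : Dec (∃[ i ] Any (λ e → e ∉ F × Incident u e) (E (tree P i)))
      avoiding-edge? = Fin.any? λ i → any? (λ e → ¬? (e ∈? F) ×-dec incident? u e) (E (tree P i))

    nice : ∀ {u} → GV P u → ∃[ e ] (GE P e × e ∉ F × GWalk F u (proj₁ e))
    nice u∈G =
      let e , e-ok@(e∈G , e∉F) , u∣e = avoiding-edge-at u∈G
      in  e , e∈G , e∉F , GWalk-along-edge e-ok u∣e (inj₁ refl)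

    cut : IsCut P F
    cut = F⊆G , proj₁ a , proj₁ b , incident⇒GV a∈G (inj₁ refl) , incident⇒GV b∈G (inj₁ refl) ,
          λ W → no-walk (GWalk⇒LGWalk W (a∈G , a∉F) (inj₁ refl) (b∈G , b∉F) (inj₁ refl))

    minimal-cut : ∀ F' → (∀ {e} → e ∈ F' → e ∈ F) → ∃[ e ] (e ∈ F × e ∉ F') → ¬ IsCut P F'
    minimal-cut F' F'⊆F strict (_ , u , v , u∈G , v∈G , no-walk-F') =
      proper-sublist-leaks F' F'⊆F strict λ a→b →
        every-vertex-touches u∈G λ (g , u∣g , g-reaches) →
          every-vertex-touches v∈G λ (h , v∣h , h-reaches) →
            no-walk-F' (LGWalk⇒GWalk (join a→b g-reaches h-reaches) u∣g v∣h)
      where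
      widen : ∀ {g h} → LGWalk F g h → LGWalk F' g h
      widen = LGWalk-antimono F'⊆F
      join : LGWalk F' a b → ∀ {g h} → ReachesAB g → ReachesAB h → LGWalk F' g h
      join a→b (inj₁ g→a) (inj₁ h→a) = widen g→a ++ʷ reverse LGAdj-sym (widen h→a)
      join a→b (inj₁ g→a) (inj₂ h→b) = widen g→a ++ʷ a→b ++ʷ reverse LGAdj-sym (widen h→b)
      join a→b (inj₂ g→b) (inj₁ h→a) =
        widen g→b ++ʷ reverse LGAdj-sym a→b ++ʷ reverse LGAdj-sym (widen h→a)
      join a→b (inj₂ g→b) (inj₂ h→b) = widen g→b ++ʷ reverse LGAdj-sym (widen h→b)

  legal-cut⇒legal-separator : ∀ {F} → IsLegalCut P F → IsLegalSeparator P F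
  legal-cut⇒legal-separator legal i {e} {e'} e∈F e∈T e'∈F e'∈T with e ≟ᴱ e'
  ... | yes e≡e' = inj₁ e≡e'
  ... | no e≢e'  = let u , _ , star = legal i in inj₂ (e≢e' , u , star e∈F e∈T , star e'∈F e'∈T)

  module Backward {F : List Edge} (nice : ∀ {u} → GV P u → ∃[ e ] (GE P e × e ∉ F × GWalk F u (proj₁ e)))
                  (F⊆G : ∀ {e} → e ∈ F → GE P e) {u v : ℕ} (u∈G : GV P u) (v∈G : GV P v)
                  (no-walk : ¬ GWalk F u v)
                  (minimal : ∀ F' → (∀ {e} → e ∈ F' → e ∈ F) → ∃[ e ] (e ∈ F × e ∉ F') → ¬ IsCut P F')
                  where

    minimal-separator : IsMinimalSeparator P F
    minimal-separator with nice u∈G | nice v∈G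
    ... | a , a∈G , a∉F , u→a | b , b∈G , b∉F , v→b =
      a , b , (F⊆G , a∈G , b∈G , a≁b , a∉F , b∉F , no-LGWalk) , minimality
      where
      disconnected : ¬ GWalk F (proj₁ a) (proj₁ b)
      disconnected a→b = no-walk (u→a ++ʷ a→b ++ʷ reverse (AdjBy-sym {E = Avoids F}) v→b)
      a≁b : ¬ LGAdj P a b
      a≁b (_ , c , c∣a , c∣b) = disconnected (GWalk-along-edge (a∈G , a∉F) (inj₁ refl) c∣a ++ʷ
                                              GWalk-along-edge (b∈G , b∉F) c∣b (inj₁ refl))
      no-LGWalk : ¬ LGWalk F a b
      no-LGWalk W = disconnected (LGWalk⇒GWalk W (inj₁ refl) (inj₁ refl))
      minimality : ∀ U → (∀ {e} → e ∈ U → e ∈ F) → ∃[ e ] (e ∈ F × e ∉ U) → ¬ IsSeparator P a b U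
      minimality U U⊆F strict (U⊆G , _ , _ , _ , a∉U , b∉U , no-walk-U) =
        minimal U U⊆F strict
          (U⊆G , proj₁ a , proj₁ b , incident⇒GV a∈G (inj₁ refl) , incident⇒GV b∈G (inj₁ refl) ,
           λ W → no-walk-U (GWalk⇒LGWalk W (a∈G , a∉U) (inj₁ refl) (b∈G , b∉U) (inj₁ refl)))

lemma2 : (P : Profile) → Connected P → (F : List Edge) → (∀ {e} → e ∈ F → GE P e) →
    ((IsLegalSeparator P F × IsMinimalSeparator P F) ⇔ (IsNiceCut P F × IsMinimalCut P F))
lemma2 P connected F F⊆G = mk⇔ separator⇒cut cut⇒separator
  where
  separator⇒cut : IsLegalSeparator P F × IsMinimalSeparator P F → IsNiceCut P F × IsMinimalCut P F
  separator⇒cut (legal , a , b , (_ , a∈G , b∈G , a≁b , a∉F , b∉F , no-walk) , minimal) =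
    (legal-separator⇒legal-cut P legal , nice) , cut , minimal-cut
    where open Forward P connected F⊆G a∈G b∈G a≁b a∉F b∉F no-walk minimal

  cut⇒separator : IsNiceCut P F × IsMinimalCut P F → IsLegalSeparator P F × IsMinimalSeparator P F
  cut⇒separator ((legal , nice) , (_ , _ , _ , u∈G , v∈G , no-walk) , minimal) =
    legal-cut⇒legal-separator P legal , minimal-separator
    where open Backward P nice F⊆G u∈G v∈G no-walk minimal
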